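{- Let $\mathsf{L}^\star$ be a logic and $\mathsf{CS}$ a constant specification as in the context, and let $\mathcal{M}^C=(W^C,W^C_0,V^C,E^C)$ be the canonical model for $\mathsf{L}^\star_{\mathsf{CS}}$. If either (1) (jd) is not in $\mathsf{L}^\star$, or (2) $\mathsf{CS}$ is axiomatically appropriate or (jt) is in $\mathsf{L}^\star$, then $\mathcal{M}^C$ is an $\mathsf{L}^\star_{\mathsf{CS}}$-subset model.
   Context: Terms $\mathsf{Tm}$: $t::=c_i\mid x_i\mid \mathsf{c}^\star\mid (t+t)\mid\ !t$ ($c_i$ constants, $x_i$ variables, $\mathsf{c}^\star$ special constant). Formulas $\mathcal{L}_J$: $F::=p_i\mid\bot\mid F\to F\mid t:F$. The $\mathsf{c}^\star$-terms: $\mathsf{c}^\star$ is one, and if $c$ is one and $s,t$ are any terms then $s+c$ and $c+t$ are. Axiom schemes: (cl) all classical propositional axioms; (j+) $s:A\lor t:A\to(s+t):A$; (jc$^\star$) $c:A\land c:(A\to B)\to c:B$ for $\mathsf{c}^\star$-terms $c$; (j4) $t:A\to\ !t:(t:A)$; (jd) $t:\bot\to\bot$; (jt) $t:A\to A$. A logic $\mathsf{L}^\star$: (cl),(j+),(jc$^\star$) plus some subset of $\{$(j4),(jd),(jt)$\}$. A constant specification $\mathsf{CS}$: set of pairs $(c,A)$, $c$ a constant, $A$ an axiom of $\mathsf{L}^\star$; it is axiomatically appropriate if for each axiom $A$ there is a constant $c$ with $(c,A)\in\mathsf{CS}$. $\mathsf{L}^\star_{\mathsf{CS}}$: Hilbert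 system with these axioms, modus ponens, and axiom necessitation (for $(c,A)\in\mathsf{CS}$ and $n\ge0$ infer $!^nc:\,!^{n-1}c:\cdots:\,!c:c:A$, $!^kc$ being $c$ preceded by $k$ copies of $!$). A set $\Gamma$ of formulas is $\mathsf{L}^\star_{\mathsf{CS}}$-consistent if $\mathsf{L}^\star_{\mathsf{CS}}\nvdash\bigwedge\Sigma\to\bot$ for every finite $\Sigma\subseteq\Gamma$; maximal consistent if consistent and no proper superset is. Canonical model: $W^C=\mathcal{P}(\mathcal{L}_J)$; $W^C_0$ = set of maximal $\mathsf{L}^\star_{\mathsf{CS}}$-consistent sets; $V^C(\Gamma,F)=1$ iff $F\in\Gamma$; with $\Gamma/t=\{F: t:F\in\Gamma\}$ and $W^C_{MP}=\{\Gamma\in W^C:$ for all $A,B$, $A\to B\in\Gamma$ and $A\in\Gamma$ imply $B\in\Gamma\}$, $E^C(\Gamma,t)=\{\Delta\in W^C_{MP}:\Delta\supseteq\Gamma/t\}$ if $t$ is a $\mathsf{c}^\star$-term and $E^C(\Gamma,t)=\{\Delta\in W^C:\Delta\supseteq\Gamma/t\}$ otherwise. An $\mathsf{L}^\star_{\mathsf{CS}}$-subset model is $(W,W_0,V,E)$ with $W$ a set, $\emptyset\neq W_0\subseteq W$, $V:W\times\mathcal{L}_J\to\{0,1\}$, $E:W\times\mathsf{Tm}\to\mathcal{P}(W)$ such that, with $[A]=\{\upsilon:V(\upsilon,A)=1\}$ and $W_{MP}=\{\upsilon\in W:$ for all $A,B$, $V(\upsilon,A)=V(\upsilon,A\to B)=1$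 implies $V(\upsilon,B)=1\}$, for all $\omega\in W_0$, $s,t\in\mathsf{Tm}$, $F,G$: $V(\omega,\bot)=0$; $V(\omega,F\to G)=1$ iff $V(\omega,F)=0$ or $V(\omega,G)=1$; $V(\omega,t:F)=1$ iff $E(\omega,t)\subseteq[F]$; $E(\omega,s+t)\subseteq E(\omega,s)\cap E(\omega,t)$; $E(\omega,\mathsf{c}^\star)\subseteq W_{MP}$; if (jd)$\in\mathsf{L}^\star$ then some $\upsilon\in W_0$ is in $E(\omega,t)$; if (jt)$\in\mathsf{L}^\star$ then $\omega\in E(\omega,t)$; if (j4)$\in\mathsf{L}^\star$ then $E(\omega,!t)\subseteq\{\upsilon:\forall F\,(V(\omega,t:F)=1\Rightarrow V(\upsilon,t:F)=1)\}$; for $(c,A)\in\mathsf{CS}$ and $n\ge1$: $E(\omega,c)\subseteq[A]$ and $E(\omega,!^nc)\subseteq[!^{n-1}c:\cdots:\,!c:c:A]$. -}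

module Defs where

open import Level using (Level; _⊔_) renaming (suc to lsuc; zero to lzero)
open import Data.Nat using (ℕ; zero; suc)
open import Data.Bool using (Bool; true; false; T; _∨_)
open import Data.List using (List; []; _∷_)
open import Data.List.Relation.Unary.All using (All)
open import Data.Product using (Σ; _×_)
open import Data.Sum using (_⊎_)
open import Relation.Nullary using (¬_)
open import Relation.Binary.PropositionalEquality using (_≡_)
open import Function.Bundles using (_⇔_)

infixl 7 _+ₜ_
data Tm : Set where
  con   : ℕ → Tm
  var   : ℕ → Tm
  cstar : Tm
  _+ₜ_  : Tm → Tm → Tm
  !ₜ    : Tm → Tm

!^ : ℕ → Tm → Tm
!^ zero    t = t
!^ (suc n) t = !ₜ (!^ n t)

isCStar : Tm → Bool
isCStar cstar    = true
isCStar (s +ₜ t) = isCStar s ∨ isCStar t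
isCStar _        = false

IsCStar : Tm → Set
IsCStar t = T (isCStar t)

infixr 5 _⇒_
infix  6 _∶_
data Fm : Set where
  atom : ℕ → Fm
  ⊥ᶠ   : Fm
  _⇒_  : Fm → Fm → Fm
  _∶_  : Tm → Fm → Fm

¬ᶠ : Fm → Fm
¬ᶠ A = A ⇒ ⊥ᶠ

⊤ᶠ : Fm
⊤ᶠ = ⊥ᶠ ⇒ ⊥ᶠ

_∨ᶠ_ : Fm → Fm → Fm
A ∨ᶠ B = ¬ᶠ A ⇒ B

_∧ᶠ_ : Fm → Fm → Fm
A ∧ᶠ B = ¬ᶠ (A ⇒ ¬ᶠ B)

⋀ : List Fm → Fm
⋀ []       = ⊤ᶠ
⋀ (A ∷ As) = A ∧ᶠ ⋀ As

-- (cl): classical propositional axioms = propositional tautologies of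
-- L_J, where atoms p_i and justification formulas t : F are treated as
-- propositional atoms.

impB : Bool → Bool → Bool
impB true  b = b
impB false _ = true

evalB : (Fm → Bool) → Fm → Bool
evalB v (atom p) = v (atom p)
evalB v ⊥ᶠ       = false
evalB v (A ⇒ B)  = impB (evalB v A) (evalB v B)
evalB v (t ∶ A)  = v (t ∶ A)

Tautology : Fm → Set
Tautology A = (v : Fm → Bool) → evalB v A ≡ true

record Logic : Set where
  field
    hasJ4 : Bool
    hasJD : Bool
    hasJT : Bool
open Logic public

data Axiom (L : Logic) : Fm → Set where
  cl     : ∀ {A} → Tautology A → Axiom L A
  jplus  : ∀ s t A → Axiom L (((s ∶ A) ∨ᶠ (t ∶ A)) ⇒ ((s +ₜ t) ∶ A))
  jcstar : ∀ c → IsCStar c → ∀ A B →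
           Axiom L (((c ∶ A) ∧ᶠ (c ∶ (A ⇒ B))) ⇒ (c ∶ B))
  j4     : hasJ4 L ≡ true → ∀ t A → Axiom L ((t ∶ A) ⇒ (!ₜ t ∶ (t ∶ A)))
  jd     : hasJD L ≡ true → ∀ t → Axiom L ((t ∶ ⊥ᶠ) ⇒ ⊥ᶠ)
  jt     : hasJT L ≡ true → ∀ t A → Axiom L ((t ∶ A) ⇒ A)

record ConstSpec (L : Logic) : Set₁ where
  field
    _∈CS_   : ℕ → Fm → Set          -- (c_i , A) ∈ CS  written  i ∈CS A
    onlyAx  : ∀ {i A} → i ∈CS A → Axiom L A
open ConstSpec public

AxiomaticallyAppropriate : (L : Logic) → ConstSpec L → Set
AxiomaticallyAppropriate L CS =
  ∀ A → Axiom L A → Σ ℕ (λ i → _∈CS_ CS i A)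

chain : ℕ → Tm → Fm → Fm
chain zero    c A = A
chain (suc n) c A = !^ n c ∶ chain n c A

necF : ℕ → Tm → Fm → Fm
necF n c A = !^ n c ∶ chain n c A

data Deriv (L : Logic) (CS : ConstSpec L) : Fm → Set where
  ax  : ∀ {A} → Axiom L A → Deriv L CS A
  mp  : ∀ {A B} → Deriv L CS (A ⇒ B) → Deriv L CS A → Deriv L CS B
  nec : ∀ {i A} → _∈CS_ CS i A → (n : ℕ) → Deriv L CS (necF n (con i) A)

FmSet : Set₁
FmSet = Fm → Set

_⊆ᶠ_ : FmSet → FmSet → Set
Γ ⊆ᶠ Δ = ∀ F → Γ F → Δ F

Consistent : (L : Logic) → ConstSpec L → FmSet → Set
Consistent L CS Γ = (Σs : List Fm) → All Γ Σs → ¬ Deriv L CS (⋀ Σs ⇒ ⊥ᶠ)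

MaxConsistent : (L : Logic) → ConstSpec L → FmSet → Set₁
MaxConsistent L CS Γ =
  Consistent L CS Γ ×
  ((Δ : FmSet) → Γ ⊆ᶠ Δ → Σ Fm (λ F → Δ F × ¬ Γ F) → ¬ Consistent L CS Δ)

record IsSubsetModel {a b c d : Level} (L : Logic) (CS : ConstSpec L)
       (W : Set a) (W₀ : W → Set b) (V : W → Fm → Set c)
       (E : W → Tm → W → Set d) : Set (lsuc (a ⊔ b ⊔ c ⊔ d)) where
  WMP : W → Set c
  WMP υ = ∀ A B → V υ A → V υ (A ⇒ B) → V υ B
  field
    W₀-nonempty : Σ W W₀
    V-⊥   : ∀ ω → W₀ ω → ¬ V ω ⊥ᶠ
    V-⇒   : ∀ ω → W₀ ω → ∀ F G → V ω (F ⇒ G) ⇔ (¬ V ω F ⊎ V ω G)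
    V-∶   : ∀ ω → W₀ ω → ∀ t F → V ω (t ∶ F) ⇔ (∀ υ → E ω t υ → V υ F)
    E-+   : ∀ ω → W₀ ω → ∀ s t υ → E ω (s +ₜ t) υ → E ω s υ × E ω t υ
    E-c⋆  : ∀ ω → W₀ ω → ∀ υ → E ω cstar υ → WMP υ
    E-jd  : hasJD L ≡ true → ∀ ω → W₀ ω → ∀ t → Σ W (λ υ → W₀ υ × E ω t υ)
    E-jt  : hasJT L ≡ true → ∀ ω → W₀ ω → ∀ t → E ω t ω
    E-j4  : hasJ4 L ≡ true → ∀ ω → W₀ ω → ∀ t υ → E ω (!ₜ t) υ →
            ∀ F → V ω (t ∶ F) → V υ (t ∶ F)
    -- n = 0: E(ω,c) ⊆ [A];  n ≥ 1: E(ω,!^n c) ⊆ [!^(n-1)c : ... : c : A]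
    E-CS  : ∀ ω → W₀ ω → ∀ i A → _∈CS_ CS i A → ∀ n υ →
            E ω (!^ n (con i)) υ → V υ (chain n (con i) A)

WC : Set₁
WC = FmSet

W₀C : (L : Logic) → ConstSpec L → WC → Set₁
W₀C L CS Γ = MaxConsistent L CS Γ

VC : WC → Fm → Set
VC Γ F = Γ F

_/ₜ_ : FmSet → Tm → FmSet
(Γ /ₜ t) F = Γ (t ∶ F)

WMPC : WC → Set
WMPC Δ = ∀ A B → Δ (A ⇒ B) → Δ A → Δ B

ECbody : Bool → WC → Tm → WC → Set
ECbody true  Γ t Δ = WMPC Δ × ((Γ /ₜ t) ⊆ᶠ Δ)
ECbody false Γ t Δ = (Γ /ₜ t) ⊆ᶠ Δ

EC : WC → Tm → WC → Set
EC Γ t Δ = ECbody (isCStar t) Γ t Δ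

-- Maximal consistent sets are closed under derivability, so (j+), (jc⋆), (j4),
-- (jt) and axiom necessitation turn directly into the corresponding conditions on
-- E^C. The one condition that asks for a new world is (jd): for every maximal
-- consistent Γ and term t we need a maximal consistent Δ ⊇ Γ/t. Under (jt), Γ itself
-- is one. If CS is axiomatically appropriate, every theorem is justified by some
-- c⋆-term c, so a derivation of ⊥ from A₁, …, Aₙ ∈ Γ/t yields (c + t) : ⊥ ∈ Γ,
-- contradicting (jd); hence Γ/t is consistent and Lindenbaum's construction, run
-- along an injective coding of formulas, extends it to the required Δ.
module Submission where

open import Defs
open import Level using (0ℓ)
open import Axiom.ExcludedMiddle using (ExcludedMiddle)
open import Data.Bool using (Bool; true; false; T; _∧_)
open import Data.Bool.Properties using (T-∧; T-∨; ∧-assoc)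
open import Data.Empty using (⊥-elim)
open import Data.List using (List; []; _∷_; _++_)
open import Data.List.Relation.Unary.All using (All; []; _∷_) renaming (map to All-map)
open import Data.List.Relation.Unary.All.Properties using (++⁺)
open import Data.Nat using (ℕ; zero; suc; _⊔_; _≤′_; ≤′-refl; ≤′-step)
open import Data.Nat.Properties using (m≤m⊔n; m≤n⊔m; ≤⇒≤′)
open import Data.Nat.Binary using (ℕᵇ; 2[1+_]; 1+[2_]; toℕ) renaming (zero to 0ᵇ)
open import Data.Nat.Binary.Properties using (2[1+_]-injective; 1+[2_]-injective; toℕ-injective)
open import Data.Product using (Σ; _×_; _,_; proj₁; proj₂)
open import Data.Sum using (_⊎_; inj₁; inj₂)
open import Data.Unit using (tt)
open import Function.Bundles using (_⇔_; mk⇔; Equivalence)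
open import Relation.Nullary using (¬_; yes; no)
open import Relation.Unary using (∅; ｛_｝; _∪_)
open import Relation.Binary.PropositionalEquality using (_≡_; refl; sym; trans; cong; cong₂; module ≡-Reasoning)

BoolFun : ℕ → Set
BoolFun zero    = Bool
BoolFun (suc n) = Bool → BoolFun n

Valid : ∀ n → BoolFun n → Set
Valid zero    b = b ≡ true
Valid (suc n) f = ∀ a → Valid n (f a)

truthTable : ∀ n → BoolFun n → Bool
truthTable zero    b = b
truthTable (suc n) f = truthTable n (f true) ∧ truthTable n (f false)

byTruthTable : ∀ n (f : BoolFun n) → {T (truthTable n f)} → Valid n f
byTruthTable zero    true            = refl
byTruthTable (suc n) f {ok} true  = byTruthTable n (f true)  {proj₁ (Equivalence.to T-∧ ok)}
byTruthTable (suc n) f {ok} false = byTruthTable n (f false) {proj₂ (Equivalence.to T-∧ ok)}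

infixr 5 _⟶_
_⟶_ : Bool → Bool → Bool
_⟶_ = impB

~_ : Bool → Bool
~ a = a ⟶ false

⟶-mp : ∀ {a b} → a ⟶ b ≡ true → a ≡ true → b ≡ true
⟶-mp a⟶b refl = a⟶b

evalB-∧ᶠ : ∀ v A B → evalB v (A ∧ᶠ B) ≡ evalB v A ∧ evalB v B
evalB-∧ᶠ v A B with evalB v A | evalB v B
... | true  | true  = refl
... | true  | false = refl
... | false | _     = refl

evalB-⋀-++ : ∀ v xs ys → evalB v (⋀ (xs ++ ys)) ≡ evalB v (⋀ xs) ∧ evalB v (⋀ ys)
evalB-⋀-++ v []       ys = refl
evalB-⋀-++ v (x ∷ xs) ys = begin
  evalB v (x ∧ᶠ ⋀ (xs ++ ys))                       ≡⟨ evalB-∧ᶠ v x (⋀ (xs ++ ys)) ⟩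
  evalB v x ∧ evalB v (⋀ (xs ++ ys))                ≡⟨ cong (evalB v x ∧_) (evalB-⋀-++ v xs ys) ⟩
  evalB v x ∧ (evalB v (⋀ xs) ∧ evalB v (⋀ ys))     ≡⟨ sym (∧-assoc (evalB v x) _ _) ⟩
  (evalB v x ∧ evalB v (⋀ xs)) ∧ evalB v (⋀ ys)     ≡⟨ cong (_∧ evalB v (⋀ ys)) (sym (evalB-∧ᶠ v x (⋀ xs))) ⟩
  evalB v (x ∧ᶠ ⋀ xs) ∧ evalB v (⋀ ys)              ∎
  where open ≡-Reasoning

taut-K : ∀ A B → Tautology (A ⇒ B ⇒ A)
taut-K A B v = byTruthTable 2 (λ a b → a ⟶ b ⟶ a) (evalB v A) (evalB v B)

taut-∧⊤-elim : ∀ A → Tautology (A ∧ᶠ ⊤ᶠ ⇒ A)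
taut-∧⊤-elim A v = byTruthTable 1 (λ a → ~ (a ⟶ ~ true) ⟶ a) (evalB v A)

taut-⊤-intro : ∀ A → Tautology (A ⇒ ⊤ᶠ)
taut-⊤-intro A v = byTruthTable 1 (λ a → a ⟶ true) (evalB v A)

taut-∧-intro : ∀ A B C → Tautology (A ⇒ (B ⇒ C) ⇒ B ⇒ A ∧ᶠ C)
taut-∧-intro A B C v =
  byTruthTable 3 (λ a b c → a ⟶ (b ⟶ c) ⟶ b ⟶ ~ (a ⟶ ~ c)) (evalB v A) (evalB v B) (evalB v C)

taut-∧-intro-self : ∀ A C → Tautology ((A ⇒ C) ⇒ A ⇒ A ∧ᶠ C)
taut-∧-intro-self A C v = byTruthTable 2 (λ a c → (a ⟶ c) ⟶ a ⟶ ~ (a ⟶ ~ c)) (evalB v A) (evalB v C)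

taut-syllogism : ∀ A B C → Tautology ((A ⇒ B) ⇒ (B ⇒ C) ⇒ A ⇒ C)
taut-syllogism A B C v =
  byTruthTable 3 (λ a b c → (a ⟶ b) ⟶ (b ⟶ c) ⟶ a ⟶ c) (evalB v A) (evalB v B) (evalB v C)

taut-explosion : ∀ A B → Tautology (¬ᶠ A ⇒ A ⇒ B)
taut-explosion A B v = byTruthTable 2 (λ a b → ~ a ⟶ a ⟶ b) (evalB v A) (evalB v B)

taut-export : ∀ A B C → Tautology ((A ∧ᶠ B ⇒ C) ⇒ B ⇒ A ⇒ C)
taut-export A B C v =
  byTruthTable 3 (λ a b c → (~ (a ⟶ ~ b) ⟶ c) ⟶ b ⟶ a ⟶ c) (evalB v A) (evalB v B) (evalB v C)

taut-∨-elimˡ : ∀ A B C → Tautology (((A ∨ᶠ B) ⇒ C) ⇒ A ⇒ C)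
taut-∨-elimˡ A B C v =
  byTruthTable 3 (λ a b c → ((~ a ⟶ b) ⟶ c) ⟶ a ⟶ c) (evalB v A) (evalB v B) (evalB v C)

taut-∨-elimʳ : ∀ A B C → Tautology (((A ∨ᶠ B) ⇒ C) ⇒ B ⇒ C)
taut-∨-elimʳ A B C v =
  byTruthTable 3 (λ a b c → ((~ a ⟶ b) ⟶ c) ⟶ b ⟶ c) (evalB v A) (evalB v B) (evalB v C)

taut-⋀-mp : ∀ xs ys A B → Tautology ((⋀ xs ⇒ A ⇒ B) ⇒ (⋀ ys ⇒ A) ⇒ ⋀ (xs ++ ys) ⇒ B)
taut-⋀-mp xs ys A B v rewrite evalB-⋀-++ v xs ys =
  byTruthTable 4 (λ x y a b → (x ⟶ a ⟶ b) ⟶ (y ⟶ a) ⟶ x ∧ y ⟶ b)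
                 (evalB v (⋀ xs)) (evalB v (⋀ ys)) (evalB v A) (evalB v B)

IsCStar-+ˡ : ∀ s t → IsCStar s → IsCStar (s +ₜ t)
IsCStar-+ˡ s t c = Equivalence.from (T-∨ {isCStar s} {isCStar t}) (inj₁ c)

IsCStar-+ʳ : ∀ s t → IsCStar t → IsCStar (s +ₜ t)
IsCStar-+ʳ s t c = Equivalence.from (T-∨ {isCStar s} {isCStar t}) (inj₂ c)

_⇒⋆_ : List Fm → Fm → Fm
[]       ⇒⋆ B = B
(A ∷ As) ⇒⋆ B = As ⇒⋆ (A ⇒ B)

erase : Fm → Bool
erase (atom _) = false
erase ⊥ᶠ       = false
erase (A ⇒ B)  = erase A ⟶ erase B
erase (t ∶ A)  = erase A

erase-chain : ∀ n c A → erase (chain n c A) ≡ erase A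
erase-chain zero    c A = refl
erase-chain (suc n) c A = erase-chain n c A

evalB-erase : ∀ A → evalB erase A ≡ erase A
evalB-erase (atom _) = refl
evalB-erase ⊥ᶠ       = refl
evalB-erase (A ⇒ B)  = cong₂ impB (evalB-erase A) (evalB-erase B)
evalB-erase (t ∶ A)  = refl

module Derivability (L : Logic) (CS : ConstSpec L) where

  infix 3 ⊢_ _⊢_

  ⊢_ : Fm → Set
  ⊢_ = Deriv L CS

  taut : ∀ {A} → Tautology A → ⊢ A
  taut τ = ax (cl τ)

  mp₂ : ∀ {A B C} → ⊢ A ⇒ B ⇒ C → ⊢ A → ⊢ B → ⊢ C
  mp₂ d a b = mp (mp d a) b

  erase-axiom : ∀ {A} → Axiom L A → erase A ≡ true
  erase-axiom {A} (cl τ)       = trans (sym (evalB-erase A)) (τ erase)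
  erase-axiom (jplus _ _ A)    = byTruthTable 1 (λ a → (~ a ⟶ a) ⟶ a) (erase A)
  erase-axiom (jcstar _ _ A B) = byTruthTable 2 (λ a b → ~ (a ⟶ ~ (a ⟶ b)) ⟶ b) (erase A) (erase B)
  erase-axiom (j4 _ _ A)       = byTruthTable 1 (λ a → a ⟶ a) (erase A)
  erase-axiom (jd _ _)         = refl
  erase-axiom (jt _ _ A)       = byTruthTable 1 (λ a → a ⟶ a) (erase A)

  erase-sound : ∀ {A} → ⊢ A → erase A ≡ true
  erase-sound (ax a)               = erase-axiom a
  erase-sound (mp d e)             = ⟶-mp (erase-sound d) (erase-sound e)
  erase-sound (nec {i} {A} i∈CS n) = trans (erase-chain n (con i) A) (erase-axiom (onlyAx CS i∈CS))

  ∅-consistent : Consistent L CS ∅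
  ∅-consistent [] [] ⊢⊤⇒⊥ with erase-sound ⊢⊤⇒⊥
  ... | ()

  +-introˡ : ∀ s t A → ⊢ s ∶ A ⇒ s +ₜ t ∶ A
  +-introˡ s t A = mp (taut (taut-∨-elimˡ (s ∶ A) (t ∶ A) (s +ₜ t ∶ A))) (ax (jplus s t A))

  +-introʳ : ∀ s t A → ⊢ t ∶ A ⇒ s +ₜ t ∶ A
  +-introʳ s t A = mp (taut (taut-∨-elimʳ (s ∶ A) (t ∶ A) (s +ₜ t ∶ A))) (ax (jplus s t A))

  c⋆-app : ∀ {c} → IsCStar c → ∀ A B → ⊢ c ∶ (A ⇒ B) ⇒ c ∶ A ⇒ c ∶ B
  c⋆-app {c} c⋆ A B = mp (taut (taut-export (c ∶ A) (c ∶ (A ⇒ B)) (c ∶ B))) (ax (jcstar c c⋆ A B))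

  ⋀⇒-to-⇒⋆ : ∀ As {B} → ⊢ ⋀ As ⇒ B → ⊢ As ⇒⋆ B
  ⋀⇒-to-⇒⋆ []           ⊢⊤⇒B  = mp ⊢⊤⇒B (taut λ _ → refl)
  ⋀⇒-to-⇒⋆ (A ∷ As) {B} ⊢A∧⇒B = ⋀⇒-to-⇒⋆ As (mp (taut (taut-export A (⋀ As) B)) ⊢A∧⇒B)

  internalize : AxiomaticallyAppropriate L CS → ∀ {A} → ⊢ A → Σ Tm λ c → IsCStar c × (⊢ c ∶ A)
  internalize aa (ax {A} a) with aa A a
  ... | i , i∈CS = cstar +ₜ con i , tt , mp (+-introʳ cstar (con i) A) (nec i∈CS 0)
  internalize aa (mp {A} {B} d e) with internalize aa d | internalize aa e
  ... | c , c⋆ , ⊢c | c' , _ , ⊢c' =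
    c +ₜ c' , IsCStar-+ˡ c c' c⋆ ,
    mp₂ (c⋆-app (IsCStar-+ˡ c c' c⋆) A B) (mp (+-introˡ c c' (A ⇒ B)) ⊢c) (mp (+-introʳ c c' A) ⊢c')
  internalize aa (nec {i} {A} i∈CS n) =
    cstar +ₜ !^ (suc n) (con i) , tt , mp (+-introʳ cstar _ _) (nec i∈CS (suc n))

  _⊢_ : FmSet → Fm → Set
  Γ ⊢ A = Σ (List Fm) λ Σs → All Γ Σs × (⊢ ⋀ Σs ⇒ A)

  consistent⇒⊬⊥ : ∀ {Γ} → Consistent L CS Γ → ¬ (Γ ⊢ ⊥ᶠ)
  consistent⇒⊬⊥ Γ-consistent (Σs , Σs⊆Γ , d) = Γ-consistent Σs Σs⊆Γ d

  ⊆-consistent : ∀ {Γ Δ} → Γ ⊆ᶠ Δ → Consistent L CS Δ → Consistent L CS Γ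
  ⊆-consistent Γ⊆Δ Δ-consistent Σs Σs⊆Γ = Δ-consistent Σs (All-map (Γ⊆Δ _) Σs⊆Γ)

  module _ {Γ : FmSet} where

    ⊢-thm : ∀ {A} → ⊢ A → Γ ⊢ A
    ⊢-thm {A} d = [] , [] , mp (taut (taut-K A ⊤ᶠ)) d

    ⊢-∈ : ∀ {A} → Γ A → Γ ⊢ A
    ⊢-∈ {A} A∈Γ = A ∷ [] , A∈Γ ∷ [] , taut (taut-∧⊤-elim A)

    ⊢-mp : ∀ {A B} → Γ ⊢ A ⇒ B → Γ ⊢ A → Γ ⊢ B
    ⊢-mp {A} {B} (xs , xs⊆Γ , d) (ys , ys⊆Γ , e) =
      xs ++ ys , ++⁺ xs⊆Γ ys⊆Γ , mp₂ (taut (taut-⋀-mp xs ys A B)) d e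

    ⊢-mp-thm : ∀ {A B} → ⊢ A ⇒ B → Γ ⊢ A → Γ ⊢ B
    ⊢-mp-thm d = ⊢-mp (⊢-thm d)

    ⊢-⋀ : ∀ {F} Σs → All (Γ ∪ ｛ F ｝) Σs → Γ ⊢ F ⇒ ⋀ Σs
    ⊢-⋀ {F} []       []                  = ⊢-thm (taut (taut-⊤-intro F))
    ⊢-⋀ {F} (x ∷ xs) (inj₁ x∈Γ ∷ xs⊆Γ,F) =
      ⊢-mp (⊢-mp-thm (taut (taut-∧-intro x F (⋀ xs))) (⊢-∈ x∈Γ)) (⊢-⋀ xs xs⊆Γ,F)
    ⊢-⋀ {F} (F ∷ xs) (inj₂ refl ∷ xs⊆Γ,F) = ⊢-mp-thm (taut (taut-∧-intro-self F (⋀ xs))) (⊢-⋀ xs xs⊆Γ,F)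

    ⊢-deduction : ∀ {F A} → (Γ ∪ ｛ F ｝) ⊢ A → Γ ⊢ F ⇒ A
    ⊢-deduction {F} {A} (Σs , Σs⊆Γ,F , d) =
      ⊢-mp (⊢-mp-thm (taut (taut-syllogism F (⋀ Σs) A)) (⊢-⋀ Σs Σs⊆Γ,F)) (⊢-thm d)

-- Formulas are written as bit strings in prefix notation; un k r prepends the
-- self-delimiting block 1ᵏ0 to r.
un : ℕ → ℕᵇ → ℕᵇ
un zero    r = 1+[2 r ]
un (suc k) r = 2[1+ un k r ]

un-injective : ∀ m n {r r'} → un m r ≡ un n r' → m ≡ n × r ≡ r'
un-injective zero    zero    eq = refl , 1+[2_]-injective eq
un-injective (suc m) (suc n) eq with un-injective m n (2[1+_]-injective eq)
... | refl , r≡r' = refl , r≡r'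

un-injectiveʳ : ∀ k {r r'} → un k r ≡ un k r' → r ≡ r'
un-injectiveʳ k eq = proj₂ (un-injective k k eq)

serialiseTm : Tm → ℕᵇ → ℕᵇ
serialiseTm (con n)  r = un 0 (un n r)
serialiseTm (var n)  r = un 1 (un n r)
serialiseTm cstar    r = un 2 r
serialiseTm (s +ₜ t) r = un 3 (serialiseTm s (serialiseTm t r))
serialiseTm (!ₜ t)   r = un 4 (serialiseTm t r)

serialiseFm : Fm → ℕᵇ → ℕᵇ
serialiseFm (atom n) r = un 0 (un n r)
serialiseFm ⊥ᶠ       r = un 1 r
serialiseFm (A ⇒ B)  r = un 2 (serialiseFm A (serialiseFm B r))
serialiseFm (t ∶ A)  r = un 3 (serialiseTm t (serialiseFm A r))

-- Clauses for distinct constructors are omitted: their bit strings already differ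
-- in the leading block, which unification detects.
serialiseTm-injective : ∀ s s' {r r'} → serialiseTm s r ≡ serialiseTm s' r' → s ≡ s' × r ≡ r'
serialiseTm-injective (con m) (con n) eq with un-injective m n (un-injectiveʳ 0 eq)
... | refl , r≡r' = refl , r≡r'
serialiseTm-injective (var m) (var n) eq with un-injective m n (un-injectiveʳ 1 eq)
... | refl , r≡r' = refl , r≡r'
serialiseTm-injective cstar cstar eq = refl , un-injectiveʳ 2 eq
serialiseTm-injective (s +ₜ t) (s' +ₜ t') eq with serialiseTm-injective s s' (un-injectiveʳ 3 eq)
... | refl , eq' with serialiseTm-injective t t' eq'
... | refl , r≡r' = refl , r≡r'
serialiseTm-injective (!ₜ t) (!ₜ t') eq with serialiseTm-injective t t' (un-injectiveʳ 4 eq)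
... | refl , r≡r' = refl , r≡r'

serialiseFm-injective : ∀ A A' {r r'} → serialiseFm A r ≡ serialiseFm A' r' → A ≡ A' × r ≡ r'
serialiseFm-injective (atom m) (atom n) eq with un-injective m n (un-injectiveʳ 0 eq)
... | refl , r≡r' = refl , r≡r'
serialiseFm-injective ⊥ᶠ ⊥ᶠ eq = refl , un-injectiveʳ 1 eq
serialiseFm-injective (A ⇒ B) (A' ⇒ B') eq with serialiseFm-injective A A' (un-injectiveʳ 2 eq)
... | refl , eq' with serialiseFm-injective B B' eq'
... | refl , r≡r' = refl , r≡r'
serialiseFm-injective (t ∶ A) (t' ∶ A') eq with serialiseTm-injective t t' (un-injectiveʳ 3 eq)
... | refl , eq' with serialiseFm-injective A A' eq'
... | refl , r≡r' = refl , r≡r'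

code : Fm → ℕ
code A = toℕ (serialiseFm A 0ᵇ)

code-injective : ∀ {A B} → code A ≡ code B → A ≡ B
code-injective {A} {B} eq = proj₁ (serialiseFm-injective A B (toℕ-injective eq))

module _ {Γ Δ : WC} where

  EC-intro : ∀ t → (IsCStar t → WMPC Δ) → (Γ /ₜ t) ⊆ᶠ Δ → EC Γ t Δ
  EC-intro t Δ-mp Γ/t⊆Δ with isCStar t
  ... | true  = Δ-mp tt , Γ/t⊆Δ
  ... | false = Γ/t⊆Δ

  EC-WMPC : ∀ t → EC Γ t Δ → IsCStar t → WMPC Δ
  EC-WMPC t e with isCStar t
  EC-WMPC t (Δ-mp , _) | true = λ _ → Δ-mp

  EC-⊆ : ∀ t → EC Γ t Δ → (Γ /ₜ t) ⊆ᶠ Δ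
  EC-⊆ t e with isCStar t
  EC-⊆ t (_ , Γ/t⊆Δ) | true  = Γ/t⊆Δ
  EC-⊆ t Γ/t⊆Δ       | false = Γ/t⊆Δ

  EC-antitone : ∀ {s s'} → (IsCStar s → IsCStar s') → (Γ /ₜ s) ⊆ᶠ (Γ /ₜ s') → EC Γ s' Δ → EC Γ s Δ
  EC-antitone {s} {s'} c⋆⇒c⋆ Γ/s⊆Γ/s' e =
    EC-intro s (λ c⋆ → EC-WMPC s' e (c⋆⇒c⋆ c⋆)) (λ F F∈Γ/s → EC-⊆ s' e F (Γ/s⊆Γ/s' F F∈Γ/s))

module Canonical (lem : ExcludedMiddle 0ℓ) (L : Logic) (CS : ConstSpec L) where

  open Derivability L CS public

  inconsistent⇒⊢⊥ : ∀ {Γ} → ¬ Consistent L CS Γ → Γ ⊢ ⊥ᶠ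
  inconsistent⇒⊢⊥ {Γ} Γ-inconsistent with lem {Γ ⊢ ⊥ᶠ}
  ... | yes Γ⊢⊥ = Γ⊢⊥
  ... | no Γ⊬⊥  = ⊥-elim (Γ-inconsistent λ Σs Σs⊆Γ d → Γ⊬⊥ (Σs , Σs⊆Γ , d))

  module MaximalConsistent {Γ : FmSet} (Γ-mc : MaxConsistent L CS Γ) where

    ∉⇒⊢¬ : ∀ {F} → ¬ Γ F → Γ ⊢ ¬ᶠ F
    ∉⇒⊢¬ {F} F∉Γ =
      ⊢-deduction (inconsistent⇒⊢⊥ (proj₂ Γ-mc (Γ ∪ ｛ F ｝) (λ _ → inj₁) (F , inj₂ refl , F∉Γ)))

    ⊢⇒∈ : ∀ {A} → Γ ⊢ A → Γ A
    ⊢⇒∈ {A} Γ⊢A with lem {Γ A}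
    ... | yes A∈Γ = A∈Γ
    ... | no A∉Γ  = ⊥-elim (consistent⇒⊬⊥ (proj₁ Γ-mc) (⊢-mp (∉⇒⊢¬ A∉Γ) Γ⊢A))

    mp-closed : WMPC Γ
    mp-closed _ _ A⇒B∈Γ A∈Γ = ⊢⇒∈ (⊢-mp (⊢-∈ A⇒B∈Γ) (⊢-∈ A∈Γ))

    ∈-thm : ∀ {A} → ⊢ A → Γ A
    ∈-thm d = ⊢⇒∈ (⊢-thm d)

    ∈-mp : ∀ {A B} → ⊢ A ⇒ B → Γ A → Γ B
    ∈-mp d = mp-closed _ _ (∈-thm d)

    ∈-mp₂ : ∀ {A B C} → ⊢ A ⇒ B ⇒ C → Γ A → Γ B → Γ C
    ∈-mp₂ d A∈Γ = mp-closed _ _ (∈-mp d A∈Γ)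

    ⊥∉ : ¬ Γ ⊥ᶠ
    ⊥∉ ⊥∈Γ = consistent⇒⊬⊥ (proj₁ Γ-mc) (⊢-∈ ⊥∈Γ)

    ⇒∈⇔ : ∀ F G → Γ (F ⇒ G) ⇔ (¬ Γ F ⊎ Γ G)
    ⇒∈⇔ F G = mk⇔ to from
      where
      to : Γ (F ⇒ G) → ¬ Γ F ⊎ Γ G
      to F⇒G∈Γ with lem {Γ F}
      ... | yes F∈Γ = inj₂ (mp-closed F G F⇒G∈Γ F∈Γ)
      ... | no F∉Γ  = inj₁ F∉Γ
      from : ¬ Γ F ⊎ Γ G → Γ (F ⇒ G)
      from (inj₁ F∉Γ) = ⊢⇒∈ (⊢-mp-thm (taut (taut-explosion F G)) (∉⇒⊢¬ F∉Γ))
      from (inj₂ G∈Γ) = ∈-mp (taut (taut-K G F)) G∈Γ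

    /ₜ-mp-closed : ∀ {t} → IsCStar t → WMPC (Γ /ₜ t)
    /ₜ-mp-closed c⋆ A B = ∈-mp₂ (c⋆-app c⋆ A B)

    ∈-app⋆ : ∀ {u} → IsCStar u → ∀ As {B} → Γ (u ∶ As ⇒⋆ B) → All (λ A → Γ (u ∶ A)) As → Γ (u ∶ B)
    ∈-app⋆ c⋆ []       u∶B∈Γ      []            = u∶B∈Γ
    ∈-app⋆ c⋆ (A ∷ As) u∶As⇒⋆A⇒B∈Γ (u∶A∈Γ ∷ rest) =
      /ₜ-mp-closed c⋆ A _ (∈-app⋆ c⋆ As u∶As⇒⋆A⇒B∈Γ rest) u∶A∈Γ

    /ₜ-consistent : hasJD L ≡ true → AxiomaticallyAppropriate L CS → ∀ t → Consistent L CS (Γ /ₜ t)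
    /ₜ-consistent jd∈L aa t Σs Σs⊆Γ/t ⊢⋀Σs⇒⊥ with internalize aa (⋀⇒-to-⇒⋆ Σs ⊢⋀Σs⇒⊥)
    ... | c , c⋆ , ⊢c∶Σs⇒⋆⊥ =
      ⊥∉ (∈-mp (ax (jd jd∈L (c +ₜ t)))
               (∈-app⋆ (IsCStar-+ˡ c t c⋆) Σs
                       (∈-thm (mp (+-introˡ c t (Σs ⇒⋆ ⊥ᶠ)) ⊢c∶Σs⇒⋆⊥))
                       (All-map (λ {A} → ∈-mp (+-introʳ c t A)) Σs⊆Γ/t)))

  module Lindenbaum {Γ : FmSet} (Γ-consistent : Consistent L CS Γ) where

    stage : ℕ → FmSet
    stage zero    = Γ
    stage (suc n) = stage n ∪ λ G → code G ≡ n × Consistent L CS (stage n ∪ ｛ G ｝)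

    stage-consistent : ∀ n → Consistent L CS (stage n)
    stage-consistent zero = Γ-consistent
    stage-consistent (suc n) with lem {Σ Fm λ G → code G ≡ n × Consistent L CS (stage n ∪ ｛ G ｝)}
    ... | yes (G , code-G≡n , G-consistent) = ⊆-consistent added-G G-consistent
      where
      added-G : stage (suc n) ⊆ᶠ (stage n ∪ ｛ G ｝)
      added-G _ (inj₁ H∈stage)      = inj₁ H∈stage
      added-G _ (inj₂ (code-H≡n , _)) = inj₂ (code-injective (trans code-G≡n (sym code-H≡n)))
    ... | no nothing-added = ⊆-consistent unchanged (stage-consistent n)
      where
      unchanged : stage (suc n) ⊆ᶠ stage n
      unchanged _ (inj₁ H∈stage) = H∈stage
      unchanged H (inj₂ added)   = ⊥-elim (nothing-added (H , added))

    stage-mono : ∀ {m n} → m ≤′ n → stage m ⊆ᶠ stage n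
    stage-mono ≤′-refl       _ A∈stage = A∈stage
    stage-mono (≤′-step m≤n) A A∈stage = inj₁ (stage-mono m≤n A A∈stage)

    limit : FmSet
    limit A = Σ ℕ λ n → stage n A

    finite⊆stage : ∀ Σs → All limit Σs → Σ ℕ λ n → All (stage n) Σs
    finite⊆stage []       []                      = 0 , []
    finite⊆stage (A ∷ As) ((m , A∈stage) ∷ As⊆limit) with finite⊆stage As As⊆limit
    ... | n , As⊆stage =
      m ⊔ n , stage-mono (≤⇒≤′ (m≤m⊔n m n)) A A∈stage ∷ All-map (stage-mono (≤⇒≤′ (m≤n⊔m m n)) _) As⊆stage

    limit-consistent : Consistent L CS limit
    limit-consistent Σs Σs⊆limit with finite⊆stage Σs Σs⊆limit
    ... | n , Σs⊆stage = stage-consistent n Σs Σs⊆stage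

    -- F is considered at stage code F and is added if it is consistent with it.
    limit-maximal : MaxConsistent L CS limit
    limit-maximal = limit-consistent , λ Δ limit⊆Δ (F , F∈Δ , F∉limit) Δ-consistent →
      F∉limit (suc (code F) , inj₂ (refl , ⊆-consistent (stage∪F⊆Δ Δ limit⊆Δ F∈Δ) Δ-consistent))
      where
      stage∪F⊆Δ : ∀ Δ → limit ⊆ᶠ Δ → ∀ {F} → Δ F → (stage (code F) ∪ ｛ F ｝) ⊆ᶠ Δ
      stage∪F⊆Δ Δ limit⊆Δ {F} F∈Δ A (inj₁ A∈stage) = limit⊆Δ A (code F , A∈stage)
      stage∪F⊆Δ Δ limit⊆Δ     F∈Δ _ (inj₂ refl)    = F∈Δ

    ⊆limit : Γ ⊆ᶠ limit
    ⊆limit _ A∈Γ = 0 , A∈Γ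

  EC-self : ∀ {Γ} → MaxConsistent L CS Γ → ∀ t → EC Γ t (Γ /ₜ t)
  EC-self Γ-mc t = EC-intro t (MaximalConsistent./ₜ-mp-closed Γ-mc) (λ _ F∈Γ/t → F∈Γ/t)

  EC-refl : hasJT L ≡ true → ∀ {Γ} → MaxConsistent L CS Γ → ∀ t → EC Γ t Γ
  EC-refl jt∈L Γ-mc t = EC-intro t (λ _ → mp-closed) (λ A → ∈-mp (ax (jt jt∈L t A)))
    where open MaximalConsistent Γ-mc

  EC-serial : hasJD L ≡ false ⊎ (AxiomaticallyAppropriate L CS ⊎ hasJT L ≡ true) →
              hasJD L ≡ true → ∀ Γ → MaxConsistent L CS Γ → ∀ t →
              Σ WC λ Δ → MaxConsistent L CS Δ × EC Γ t Δ
  EC-serial (inj₁ jd∉L) jd∈L _ _ _ with trans (sym jd∉L) jd∈L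
  ... | ()
  EC-serial (inj₂ (inj₁ aa)) jd∈L _ Γ-mc t =
    limit , limit-maximal , EC-intro t (λ _ → MaximalConsistent.mp-closed limit-maximal) ⊆limit
    where open Lindenbaum (MaximalConsistent./ₜ-consistent Γ-mc jd∈L aa t)
  EC-serial (inj₂ (inj₂ jt∈L)) _ Γ Γ-mc t = Γ , Γ-mc , EC-refl jt∈L Γ-mc t

mainTheorem5 : ExcludedMiddle 0ℓ → (L : Logic) (CS : ConstSpec L) →
    (hasJD L ≡ false ⊎ (AxiomaticallyAppropriate L CS ⊎ hasJT L ≡ true)) →
    IsSubsetModel L CS WC (W₀C L CS) VC EC
mainTheorem5 lem L CS hyp = record
  { W₀-nonempty = limit , limit-maximal
  ; V-⊥         = λ _ → ⊥∉
  ; V-⇒         = λ _ → ⇒∈⇔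
  ; V-∶         = λ Γ Γ-mc t F →
      mk⇔ (λ t∶F∈Γ Δ e → EC-⊆ t e F t∶F∈Γ) (λ t∶F-everywhere → t∶F-everywhere (Γ /ₜ t) (EC-self Γ-mc t))
  ; E-+         = λ _ Γ-mc s t _ e →
      EC-antitone (IsCStar-+ˡ s t) (λ A → ∈-mp Γ-mc (+-introˡ s t A)) e ,
      EC-antitone (IsCStar-+ʳ s t) (λ A → ∈-mp Γ-mc (+-introʳ s t A)) e
  ; E-c⋆        = λ _ _ _ (Δ-mp , _) A B A∈Δ A⇒B∈Δ → Δ-mp A B A⇒B∈Δ A∈Δ
  ; E-jd        = EC-serial hyp
  ; E-jt        = λ jt∈L _ Γ-mc → EC-refl jt∈L Γ-mc
  ; E-j4        = λ j4∈L Γ Γ-mc t Δ e F t∶F∈Γ → EC-⊆ {Γ} {Δ} (!ₜ t) e (t ∶ F) (∈-mp Γ-mc (ax (j4 j4∈L t F)) t∶F∈Γ)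
  ; E-CS        = λ _ Γ-mc i A i∈CS n _ e → EC-⊆ (!^ n (con i)) e _ (∈-thm Γ-mc (nec i∈CS n))
  }
  where
  open Canonical lem L CS
  open Lindenbaum ∅-consistent
  open MaximalConsistent
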